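{- Let $H=\mathcal{H}(G)$ be the injective hull of a graph $G$. For any shortest path $P(x,y)$ in $H$ between vertices $x,y\in V(H)$, there are real vertices $x',y'\in V(G)$ and a shortest $(x',y')$-path $P(x',y')$ in $H$ with $P(x',y')\supseteq P(x,y)$.
   Context: All graphs are finite, simple, undirected, unweighted and connected. A graph is Helly if every family of pairwise intersecting disks $D(v,r)=\{u: d(u,v)\le r\}$ has a common vertex. The injective hull $\mathcal{H}(G)$ is the unique minimal Helly graph containing $G$ as an isometric subgraph; vertices of its copy of $G$ are the real vertices. -}

module Defs where

open import Data.Nat using (ℕ; zero; suc; _≤_)
open import Data.Fin using (Fin)
open import Data.Bool using (Bool; T; false)
open import Relation.Binary.PropositionalEquality using (_≡_)
open import Data.List using (List; []; _∷_)
open import Data.List.Relation.Unary.All using (All)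
open import Data.Product using (Σ; ∃; _×_; _,_; proj₁)
open import Data.Sum using (_⊎_)
open import Data.Fin.Subset using (Subset) renaming (_∈_ to _∈ₛ_)
import Data.List.Membership.Propositional as LM
open import Relation.Nullary using (¬_)
open import Function.Bundles using (_⇔_)

module _ {V : Set} (A : V → V → Set) where

  data Walk : V → V → ℕ → Set where
    here : ∀ {u} → Walk u u 0
    step : ∀ {u v w k} → A u v → Walk v w k → Walk u w (suc k)

  Dist : V → V → ℕ → Set
  Dist u v k = Walk u v k × (∀ m → Walk u v m → k ≤ m)

  IsShortest : ∀ {u v k} → Walk u v k → Set
  IsShortest {u} {v} {k} _ = ∀ m → Walk u v m → k ≤ m

  InDisk : V × ℕ → V → Set
  InDisk (c , r) u = ∃ λ k → k ≤ r × Walk c u k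

  IsHelly : Set
  IsHelly = ∀ (F : List (V × ℕ)) →
            (∀ D₁ D₂ → D₁ LM.∈ F → D₂ LM.∈ F → ∃ λ u → InDisk D₁ u × InDisk D₂ u) →
            ∃ λ u → All (λ D → InDisk D u) F

  vertices : ∀ {u v k} → Walk u v k → List V
  vertices {u} here = u ∷ []
  vertices {u} (step _ w) = u ∷ vertices w

  edges : ∀ {u v k} → Walk u v k → List (V × V)
  edges here = []
  edges {u} (step {v = v} _ w) = (u , v) ∷ edges w

  SubgraphOf : ∀ {u v k u' v' k'} → Walk u v k → Walk u' v' k' → Set
  SubgraphOf P P' =
    All (λ x → x LM.∈ vertices P') (vertices P) ×
    All (λ e → (proj₁ e , Data.Product.proj₂ e) LM.∈ edges P'
             ⊎ (Data.Product.proj₂ e , proj₁ e) LM.∈ edges P') (edges P)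

record Graph : Set where
  field
    n          : ℕ
    edge       : Fin n → Fin n → Bool
    edge-sym   : ∀ u v → edge u v ≡ edge v u
    edge-irrefl : ∀ u → edge u u ≡ false
    nonempty   : Fin n
    connected  : ∀ u v → ∃ λ k → Walk (λ a b → T (edge a b)) u v k

  V : Set
  V = Fin n

  Adj : V → V → Set
  Adj a b = T (edge a b)

open Graph public

IsIsometric : (G H : Graph) → (V G → V H) → Set
IsIsometric G H f = ∀ u v k → Dist (Adj G) u v k ⇔ Dist (Adj H) (f u) (f v) k

InducedAdj : (H : Graph) (S : Subset (n H)) → Σ (V H) (_∈ₛ S) → Σ (V H) (_∈ₛ S) → Set
InducedAdj H S a b = Adj H (proj₁ a) (proj₁ b)

IsIsometricSub : (H : Graph) (S : Subset (n H)) → Set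
IsIsometricSub H S = ∀ a b k → Dist (InducedAdj H S) a b k ⇔ Dist (Adj H) (proj₁ a) (proj₁ b) k

IsInjectiveHull : (G H : Graph) → (V G → V H) → Set
IsInjectiveHull G H f =
  IsHelly (Adj H) ×
  IsIsometric G H f ×
  (∀ (S : Subset (n H)) → (∀ v → f v ∈ₛ S) → IsIsometricSub H S →
     IsHelly (InducedAdj H S) → ∀ x → x ∈ₛ S)

module Submission where

-- The heart of the proof is the gate lemma: for a shortest (x,y)-path P of
-- length k there is a real vertex u with d(u,y) = d(u,x) + k, so that a
-- geodesic from u to x followed by P is again a shortest path.  Applying it
-- once at each end of P gives the theorem.
--
-- The gate lemma is proved by contradiction.  If d(u,y) ≤ d(u,x) + k - 1 for
-- every real u, the Helly property yields a vertex z with d(y,z) ≤ k - 1 and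
-- d(u,z) ≤ d(u,x) for all real u.  Sending x to z and fixing y and G is then a
-- nonexpansive partial map, which extends (Helly again) to a nonexpansive
-- self-map r of H.  A suitable power e of r is idempotent; its fixed-point set
-- is a retract of H, hence an isometric Helly subgraph containing G, so by the
-- minimality of the hull e is the identity.  Hence some power of r maps z back
-- to x while fixing y, producing an (x,y)-walk of length ≤ k - 1.

open import Defs
open import Data.Product using (∃; _×_; Σ; _,_; proj₁; proj₂; ∃₂)
open import Data.Nat using (ℕ; zero; suc; _+_; _*_; _∸_; _≤_; _<_; z≤n; s≤s; _!)
open import Data.Nat.Properties
open import Data.Nat.Divisibility using (divides; ∣-trans; m∣m*n; ∣n⇒∣m*n; m≤n⇒m!∣n!)
open import Data.Fin using (Fin; toℕ) renaming (_≟_ to _≟F_)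
open import Data.Fin.Properties using (any?; all?; ¬∀⟶∃¬; pigeonhole; toℕ<n)
open import Data.Fin.Subset using (Subset) renaming (_∈_ to _∈ₛ_)
open import Data.Bool using (T)
open import Data.List using (List; []; _∷_; map; allFin)
open import Data.List.Relation.Unary.All as All using (All; []; _∷_)
open import Data.List.Relation.Unary.All.Properties using (map⁻)
open import Data.List.Relation.Unary.Any using (here; there)
open import Data.List.Membership.Propositional using (_∈_)
open import Data.List.Membership.Propositional.Properties using (∈-map⁻; ∈-map⁺; ∈-allFin)
open import Data.List.Relation.Binary.Subset.Propositional using (_⊆_)
open import Data.Sum using (_⊎_; inj₁; inj₂)
open import Data.Empty using (⊥; ⊥-elim)
open import Relation.Nullary using (Dec; yes; no; does)
open import Relation.Nullary.Decidable using (dec-true; T?; _×-dec_)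
open import Relation.Binary.PropositionalEquality
open import Function.Base using (_∘_; id)
open import Function.Bundles using (mk⇔)
open import Data.Vec using (tabulate)
open import Data.Vec.Properties using (lookup⇒[]=; []=⇒lookup; lookup∘tabulate)
open import Data.Vec.Properties.WithK using ([]=-irrelevant)
import Function.Endo.Propositional as Endo

module _ {V : Set} {A : V → V → Set} where

  infixr 5 _++w_

  _++w_ : ∀ {a b c m l} → Walk A a b m → Walk A b c l → Walk A a c (m + l)
  here ++w Q = Q
  step e P ++w Q = step e (P ++w Q)

  walk-zero : ∀ {a b} → Walk A a b 0 → a ≡ b
  walk-zero here = refl

  vertices-start : ∀ {a b l x} (Q : Walk A a b l) → x ≡ a → x ∈ vertices A Q
  vertices-start here eq = here eq
  vertices-start (step _ _) eq = here eq

  vertices-++ˡ : ∀ {a b c m l x} (P : Walk A a b m) (Q : Walk A b c l) →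
                 x ∈ vertices A P → x ∈ vertices A (P ++w Q)
  vertices-++ˡ here Q (here eq) = vertices-start Q eq
  vertices-++ˡ (step _ _) Q (here eq) = here eq
  vertices-++ˡ (step _ P) Q (there i) = there (vertices-++ˡ P Q i)

  vertices-++ʳ : ∀ {a b c m l x} (P : Walk A a b m) (Q : Walk A b c l) →
                 x ∈ vertices A Q → x ∈ vertices A (P ++w Q)
  vertices-++ʳ here Q i = i
  vertices-++ʳ (step _ P) Q i = there (vertices-++ʳ P Q i)

  edges-++ˡ : ∀ {a b c m l x} (P : Walk A a b m) (Q : Walk A b c l) →
              x ∈ edges A P → x ∈ edges A (P ++w Q)
  edges-++ˡ (step _ _) Q (here eq) = here eq
  edges-++ˡ (step _ P) Q (there i) = there (edges-++ˡ P Q i)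

  edges-++ʳ : ∀ {a b c m l x} (P : Walk A a b m) (Q : Walk A b c l) →
              x ∈ edges A Q → x ∈ edges A (P ++w Q)
  edges-++ʳ here Q i = i
  edges-++ʳ (step _ P) Q i = there (edges-++ʳ P Q i)

  subgraph-middle : ∀ {a b c d m k l} (Q : Walk A a b m) (P : Walk A b c k) (R : Walk A c d l) →
                    SubgraphOf A P (Q ++w (P ++w R))
  subgraph-middle Q P R =
    All.tabulate (λ i → vertices-++ʳ Q _ (vertices-++ˡ P R i)) ,
    All.tabulate (λ i → inj₁ (edges-++ʳ Q _ (edges-++ˡ P R i)))

mapWalk : ∀ {V W : Set} {A : V → V → Set} {B : W → W → Set} (g : V → W) →
          (∀ {a b} → A a b → B (g a) (g b)) → ∀ {a b m} → Walk A a b m → Walk B (g a) (g b) m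
mapWalk g hom here = here
mapWalk g hom (step e P) = step (hom e) (mapWalk g hom P)

Within : {V : Set} (A : V → V → Set) → V → V → ℕ → Set
Within A a b L = InDisk A (a , L) b

module _ {V : Set} {A : V → V → Set} where

  within-here : ∀ {a L} → Within A a a L
  within-here = 0 , z≤n , here

  within-walk : ∀ {a b m} → Walk A a b m → Within A a b m
  within-walk P = _ , ≤-refl , P

  within-weaken : ∀ {a b L L'} → L ≤ L' → Within A a b L → Within A a b L'
  within-weaken L≤L' (m , m≤L , P) = m , ≤-trans m≤L L≤L' , P

  within-zero : ∀ {a b} → Within A a b 0 → a ≡ b
  within-zero (zero , _ , P) = walk-zero P

  within-one : ∀ {a b} → Within A a b 1 → a ≡ b ⊎ A a b
  within-one (zero , _ , P) = inj₁ (walk-zero P)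
  within-one (suc zero , _ , step e here) = inj₂ e
  within-one (suc (suc _) , s≤s () , _)

  split-walk : ∀ {a b m} p q → Walk A a b m → m ≤ p + q →
               ∃ λ w → Within A a w p × Within A w b q
  split-walk {a} zero q P m≤q = a , within-here , (_ , m≤q , P)
  split-walk {a} (suc p) q here _ = a , within-here , within-here
  split-walk (suc p) q (step e P) (s≤s m≤p+q) with split-walk p q P m≤p+q
  ... | w , (l , l≤p , P₁) , wb = w , (suc l , s≤s l≤p , step e P₁) , wb

module _ {V : Set} {A : V → V → Set} (A-sym : ∀ {a b} → A a b → A b a) where

  reverse : ∀ {a b m} → Walk A a b m → Walk A b a m
  reverse here = here
  reverse {m = suc m} (step e P) =
    subst (Walk A _ _) (+-comm m 1) (reverse P ++w step (A-sym e) here)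

  within-sym : ∀ {a b L} → Within A a b L → Within A b a L
  within-sym (m , m≤L , P) = m , m≤L , reverse P

module Metric (H : Graph) where

  adj-sym : ∀ {a b} → Adj H a b → Adj H b a
  adj-sym {a} {b} = subst T (edge-sym H a b)

  rev : ∀ {a b m} → Walk (Adj H) a b m → Walk (Adj H) b a m
  rev = reverse adj-sym

  within-rev : ∀ {a b L} → Within (Adj H) a b L → Within (Adj H) b a L
  within-rev = within-sym adj-sym

  -- "d(a,b) ≤ L" is decidable: either a = b or some neighbour of a is within L - 1 of b
  within? : ∀ L a b → Dec (Within (Adj H) a b L)
  within? zero a b with a ≟F b
  ... | yes refl = yes within-here
  ... | no a≢b = no (a≢b ∘ within-zero)
  within? (suc L) a b with a ≟F b
  ... | yes refl = yes within-here
  ... | no a≢b with any? (λ w → T? (edge H a w) ×-dec within? L w b)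
  ... | yes (w , e , (m , m≤L , P)) = yes (suc m , s≤s m≤L , step e P)
  ... | no none = no λ { (zero , _ , P) → a≢b (walk-zero P)
                       ; (suc m , s≤s m≤L , step e P) → none (_ , e , m , m≤L , P) }

  -- if d(a,b) ≤ K, the distance d(a,b) exists: search downwards from K
  distance-below : ∀ K {a b} → Within (Adj H) a b K → ∃ (Dist (Adj H) a b)
  distance-below zero (zero , _ , P) = 0 , P , λ _ _ → z≤n
  distance-below (suc K) {a} {b} (m , m≤K , P) with within? K a b
  ... | yes a-b≤K = distance-below K a-b≤K
  ... | no a-b≰K = m , P , λ m' P' →
          ≮⇒≥ λ m'<m → a-b≰K (m' , ≤-pred (≤-trans m'<m m≤K) , P')

  distance : ∀ a b → ∃ (Dist (Adj H) a b)
  distance a b with connected H a b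
  ... | K , P = distance-below K (within-walk P)

  d : V H → V H → ℕ
  d a b = proj₁ (distance a b)

  geodesic : ∀ a b → Walk (Adj H) a b (d a b)
  geodesic a b = proj₁ (proj₂ (distance a b))

  d-min : ∀ {a b m} → Walk (Adj H) a b m → d a b ≤ m
  d-min {a} {b} {m} = proj₂ (proj₂ (distance a b)) m

  reverse-shortest : ∀ {a b m} (P : Walk (Adj H) a b m) →
                     IsShortest (Adj H) P → IsShortest (Adj H) (rev P)
  reverse-shortest _ P-short m W = P-short m (rev W)

  reverse-shortest-regroup :
    ∀ {a b x y m k l} (Q₁ : Walk (Adj H) a x m) (P : Walk (Adj H) x y k) (Q₂ : Walk (Adj H) b y l) →
    IsShortest (Adj H) (Q₂ ++w rev (Q₁ ++w P)) → IsShortest (Adj H) (Q₁ ++w (P ++w rev Q₂))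
  reverse-shortest-regroup {m = m} {k} {l} _ _ _ short n W =
    subst (_≤ n) (trans (+-comm l (m + k)) (+-assoc m k l)) (short n (rev W))

module Nonexpansive (H : Graph) where

  open Metric H
  open Endo (V H) using (_^_)

  IsNonexpansive : (V H → V H) → Set
  IsNonexpansive r = ∀ {a b m} → Walk (Adj H) a b m → Within (Adj H) (r a) (r b) m

  ^-nonexpansive : ∀ {r} → IsNonexpansive r → ∀ j → IsNonexpansive (r ^ j)
  ^-nonexpansive r-ne zero P = within-walk P
  ^-nonexpansive r-ne (suc j) P with ^-nonexpansive r-ne j P
  ... | m' , m'≤m , P' = within-weaken m'≤m (r-ne P')

  ^-fixes : ∀ {r a} → r a ≡ a → ∀ j → (r ^ j) a ≡ a
  ^-fixes ra≡a zero = refl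
  ^-fixes {r} ra≡a (suc j) = trans (cong r (^-fixes ra≡a j)) ra≡a

  -- a partial map, listed as pairs (a , image of a), is nonexpansive
  IsNonexpansiveList : List (V H × V H) → Set
  IsNonexpansiveList L = ∀ {a p b q} → (a , p) ∈ L → (b , q) ∈ L →
                         ∀ {m} → Walk (Adj H) a b m → Within (Adj H) p q m

  move-one : ∀ {x z} (cs : List (V H)) →
             All (λ c → ∀ {m} → Walk (Adj H) c x m → Within (Adj H) c z m) cs →
             IsNonexpansiveList ((x , z) ∷ map (λ c → c , c) cs)
  move-one cs closer (here refl) (here refl) _ = within-here
  move-one cs closer (here refl) (there j) W with ∈-map⁻ _ j
  ... | _ , c∈cs , refl = within-rev (All.lookup closer c∈cs (rev W))
  move-one cs closer (there i) (here refl) W with ∈-map⁻ _ i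
  ... | _ , c∈cs , refl = All.lookup closer c∈cs W
  move-one cs closer (there i) (there j) W with ∈-map⁻ _ i | ∈-map⁻ _ j
  ... | _ , _ , refl | _ , _ , refl = within-walk W

  module HellyExtension (helly : IsHelly (Adj H)) where

    -- a nonexpansive partial map extends to any further vertex v: the disks
    -- D(q, d(v,a)) for (a , q) ∈ L pairwise meet, as d(q,q') ≤ d(a,a') ≤ d(v,a) + d(v,a')
    extend-one : ∀ L → IsNonexpansiveList L → ∀ v → ∃ λ p → IsNonexpansiveList ((v , p) ∷ L)
    extend-one L L-ne v = p , extended
      where
        disk : V H × V H → V H × ℕ
        disk (a , q) = q , d v a

        meet : ∀ D₁ D₂ → D₁ ∈ map disk L → D₂ ∈ map disk L →
               ∃ λ u → InDisk (Adj H) D₁ u × InDisk (Adj H) D₂ u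
        meet _ _ i₁ i₂ with ∈-map⁻ disk i₁ | ∈-map⁻ disk i₂
        ... | (a , q) , j₁ , refl | (a' , q') , j₂ , refl
          with L-ne j₁ j₂ (rev (geodesic v a) ++w geodesic v a')
        ... | m , m≤ , W with split-walk (d v a) (d v a') W m≤
        ... | u , qu , uq' = u , qu , within-rev uq'

        p : V H
        p = proj₁ (helly (map disk L) meet)

        near : ∀ {a q} → (a , q) ∈ L → Within (Adj H) q p (d v a)
        near = All.lookup (map⁻ (proj₂ (helly (map disk L) meet)))

        extended : IsNonexpansiveList ((v , p) ∷ L)
        extended (here refl) (here refl) _ = within-here
        extended (here refl) (there j) W = within-weaken (d-min W) (within-rev (near j))
        extended (there i) (here refl) W = within-weaken (d-min (rev W)) (near i)
        extended (there i) (there j) W = L-ne i j W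

    extend-list : ∀ (vs : List (V H)) L → IsNonexpansiveList L →
                  ∃ λ L' → IsNonexpansiveList L' × L ⊆ L' × All (λ v → ∃ λ p → (v , p) ∈ L') vs
    extend-list [] L L-ne = L , L-ne , (λ i → i) , []
    extend-list (v ∷ vs) L L-ne with extend-one L L-ne v
    ... | p , L₁-ne with extend-list vs ((v , p) ∷ L) L₁-ne
    ... | L' , L'-ne , L₁⊆L' , covered =
          L' , L'-ne , L₁⊆L' ∘ there , (p , L₁⊆L' (here refl)) ∷ covered

    extend : ∀ L → IsNonexpansiveList L →
             ∃ λ r → IsNonexpansive r × (∀ {a q} → (a , q) ∈ L → r a ≡ q)
    extend L L-ne with extend-list (allFin (n H)) L L-ne
    ... | L' , L'-ne , L⊆L' , covered = r , r-ne , r-agrees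
      where
        image : ∀ v → ∃ λ p → (v , p) ∈ L'
        image v = All.lookup covered (∈-allFin v)

        r : V H → V H
        r v = proj₁ (image v)

        r-ne : IsNonexpansive r
        r-ne {a} {b} = L'-ne (proj₂ (image a)) (proj₂ (image b))

        r-agrees : ∀ {a q} → (a , q) ∈ L → r a ≡ q
        r-agrees a↦q = within-zero (L'-ne (proj₂ (image _)) (L⊆L' a↦q) here)

-- Some power of every self-map of a finite set is idempotent

stable-exponent : ℕ → ℕ
stable-exponent N = N * N !

stable-exponent-positive : ∀ {N} → Fin N → 1 ≤ stable-exponent N
stable-exponent-positive {suc N} _ = ≤-trans (s≤s z≤n) (m≤m*n (suc N) (suc N !) {{suc N !≢0}})

module Stabilisation {N : ℕ} (r : Fin N → Fin N) where

  open Endo (Fin N) using (_^_; ^-homo)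

  ^-+ : ∀ i j v → (r ^ (i + j)) v ≡ (r ^ i) ((r ^ j) v)
  ^-+ i j = cong-app (^-homo r i j)

  -- by pigeonhole, the orbit of v becomes periodic after at most N steps,
  -- with a period between 1 and N
  eventually-periodic : ∀ v → ∃₂ λ a p → a ≤ N × 0 < p × p ≤ N × (r ^ (p + a)) v ≡ (r ^ a) v
  eventually-periodic v with pigeonhole (n<1+n N) (λ i → (r ^ toℕ i) v)
  ... | i , j , i<j , same =
        toℕ i , toℕ j ∸ toℕ i , ≤-trans (<⇒≤ i<j) j≤N , m<n⇒0<n∸m i<j ,
        ≤-trans (m∸n≤m (toℕ j) (toℕ i)) j≤N ,
        trans (cong (λ t → (r ^ t) v) (m∸n+n≡m (<⇒≤ i<j))) (sym same)
    where
      j≤N : toℕ j ≤ N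
      j≤N = ≤-pred (toℕ<n j)

  periodic-after : ∀ {v a p} → (r ^ (p + a)) v ≡ (r ^ a) v →
                   ∀ c s → (r ^ (c * p + (s + a))) v ≡ (r ^ (s + a)) v
  periodic-after period zero s = refl
  periodic-after {v} {a} {p} period (suc c) s = begin
    (r ^ ((p + c * p) + (s + a))) v   ≡⟨ cong (λ t → (r ^ t) v) (+-assoc p (c * p) (s + a)) ⟩
    (r ^ (p + (c * p + (s + a)))) v   ≡⟨ ^-+ p _ v ⟩
    (r ^ p) ((r ^ (c * p + (s + a))) v) ≡⟨ cong (r ^ p) (periodic-after period c s) ⟩
    (r ^ p) ((r ^ (s + a)) v)         ≡⟨ sym (^-+ p (s + a) v) ⟩
    (r ^ (p + (s + a))) v             ≡⟨ cong (λ t → (r ^ t) v) (+-comm-middle p s a) ⟩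
    (r ^ (s + (p + a))) v             ≡⟨ ^-+ s (p + a) v ⟩
    (r ^ s) ((r ^ (p + a)) v)         ≡⟨ cong (r ^ s) period ⟩
    (r ^ s) ((r ^ a) v)               ≡⟨ sym (^-+ s a v) ⟩
    (r ^ (s + a)) v                   ∎
    where
      open ≡-Reasoning
      +-comm-middle : ∀ x y z → x + (y + z) ≡ y + (x + z)
      +-comm-middle x y z = trans (sym (+-assoc x y z)) (trans (cong (_+ z) (+-comm x y)) (+-assoc y x z))

  -- every period p ≤ N divides N!, and every preperiod a ≤ N is at most N * N!,
  -- so r ^ (N * N!) is idempotent
  stable-idempotent : ∀ v → (r ^ stable-exponent N) ((r ^ stable-exponent N) v) ≡ (r ^ stable-exponent N) v
  stable-idempotent v with eventually-periodic v
  ... | a , suc q , a≤N , _ , p≤N , period with ∣n⇒∣m*n N (∣-trans (m∣m*n (q !)) (m≤n⇒m!∣n! p≤N))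
  ... | divides c M≡cp = begin
    (r ^ M) ((r ^ M) v)             ≡⟨ sym (^-+ M M v) ⟩
    (r ^ (M + M)) v                 ≡⟨ cong (λ t → (r ^ (t + M)) v) M≡cp ⟩
    (r ^ (c * suc q + M)) v         ≡⟨ cong (λ t → (r ^ (c * suc q + t)) v) M≡s+a ⟩
    (r ^ (c * suc q + (s + a))) v   ≡⟨ periodic-after period c s ⟩
    (r ^ (s + a)) v                 ≡⟨ cong (λ t → (r ^ t) v) (sym M≡s+a) ⟩
    (r ^ M) v                       ∎
    where
      open ≡-Reasoning
      M : ℕ
      M = stable-exponent N
      s : ℕ
      s = M ∸ a
      M≡s+a : M ≡ s + a
      M≡s+a = sym (m∸n+n≡m (≤-trans a≤N (m≤m*n N (N !) {{N !≢0}})))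

module Retract (H : Graph) (e : V H → V H)
               (e-ne : Nonexpansive.IsNonexpansive H e) (e-idem : ∀ v → e (e v) ≡ e v) where

  Fixed : Subset (n H)
  Fixed = tabulate (λ v → does (e v ≟F v))

  fixed⇒∈ : ∀ {v} → e v ≡ v → v ∈ₛ Fixed
  fixed⇒∈ {v} ev≡v = lookup⇒[]= v Fixed (trans (lookup∘tabulate _ v) (dec-true (e v ≟F v) ev≡v))

  ∈⇒fixed : ∀ {v} → v ∈ₛ Fixed → e v ≡ v
  ∈⇒fixed {v} v∈ with e v ≟F v | trans (sym (lookup∘tabulate (λ v → does (e v ≟F v)) v)) ([]=⇒lookup v∈)
  ... | yes ev≡v | _ = ev≡v
  ... | no _ | ()

  image-fixed : ∀ v → e v ∈ₛ Fixed
  image-fixed v = fixed⇒∈ (e-idem v)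

  VS : Set
  VS = Σ (V H) (_∈ₛ Fixed)

  AS : VS → VS → Set
  AS = InducedAdj H Fixed

  VS-≡ : ∀ {s t : VS} → proj₁ s ≡ proj₁ t → s ≡ t
  VS-≡ {a , p} {.a , q} refl = cong (a ,_) ([]=-irrelevant p q)

  project : ∀ {s t m} → Walk AS s t m → Walk (Adj H) (proj₁ s) (proj₁ t) m
  project = mapWalk proj₁ id

  -- e maps an (a,b)-walk of H to a walk of the subgraph from e a to e b that
  -- is no longer (edges collapse or stay edges)
  retract-walk : ∀ {a b m} → Walk (Adj H) a b m → (s t : VS) →
                 proj₁ s ≡ e a → proj₁ t ≡ e b → Within AS s t m
  retract-walk here s t s≡ea t≡eb = 0 , z≤n , subst (λ t → Walk AS s t 0) (VS-≡ (trans s≡ea (sym t≡eb))) here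
  retract-walk {a} (step {v = c} ac P) s t s≡ea t≡eb
    with retract-walk P (e c , image-fixed c) t refl t≡eb | within-one (e-ne (step ac here))
  ... | m' , m'≤ , Q | inj₁ ea≡ec =
        m' , m≤n⇒m≤1+n m'≤ , subst (λ s → Walk AS s t m') (VS-≡ (sym (trans s≡ea ea≡ec))) Q
  ... | m' , m'≤ , Q | inj₂ ea-ec =
        suc m' , s≤s m'≤ , step (subst (λ x → Adj H x (e c)) (sym s≡ea) ea-ec) Q

  within-Fixed : ∀ {s t m} → Walk (Adj H) (proj₁ s) (proj₁ t) m → Within AS s t m
  within-Fixed {s} {t} P = retract-walk P s t (sym (∈⇒fixed (proj₂ s))) (sym (∈⇒fixed (proj₂ t)))

  fixed-isometric : IsIsometricSub H Fixed
  fixed-isometric s t k = mk⇔ to from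
    where
      to : Dist AS s t k → Dist (Adj H) (proj₁ s) (proj₁ t) k
      to (P , P-min) = project P , λ m W → bound (within-Fixed W)
        where
          bound : ∀ {m} → Within AS s t m → k ≤ m
          bound (m' , m'≤m , Q) = ≤-trans (P-min m' Q) m'≤m
      from : Dist (Adj H) (proj₁ s) (proj₁ t) k → Dist AS s t k
      from (P , P-min) with within-Fixed P
      ... | m' , m'≤k , Q with ≤-antisym m'≤k (P-min m' (project Q))
      ... | refl = Q , λ m Q' → P-min m (project Q')

  -- the retraction of a Helly common point of the projected disks is a common point in the subgraph
  fixed-helly : IsHelly (Adj H) → IsHelly AS
  fixed-helly helly F F-meet with helly (map underlying F) meet
    where
      underlying : VS × ℕ → V H × ℕ
      underlying (s , ρ) = proj₁ s , ρ
      meet : ∀ D₁ D₂ → D₁ ∈ map underlying F → D₂ ∈ map underlying F →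
             ∃ λ u → InDisk (Adj H) D₁ u × InDisk (Adj H) D₂ u
      meet _ _ i₁ i₂ with ∈-map⁻ underlying i₁ | ∈-map⁻ underlying i₂
      ... | _ , j₁ , refl | _ , j₂ , refl with F-meet _ _ j₁ j₂
      ... | u , (k₁ , k₁≤ , P₁) , (k₂ , k₂≤ , P₂) = proj₁ u , (k₁ , k₁≤ , project P₁) , (k₂ , k₂≤ , project P₂)
  ... | u , u∈all = (e u , image-fixed u) , All.tabulate in-disk
    where
      in-disk : ∀ {D} → D ∈ F → InDisk AS D (e u , image-fixed u)
      in-disk {c , ρ} i with All.lookup (map⁻ u∈all) i
      ... | k , k≤ρ , P with retract-walk P c (e u , image-fixed u) (sym (∈⇒fixed (proj₂ c))) refl
      ... | m' , m'≤k , Q = m' , ≤-trans m'≤k k≤ρ , Q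

module Rigidity (G H : Graph) (f : V G → V H) (hull : IsInjectiveHull G H f) where

  open Nonexpansive H
  open Endo (V H) using (_^_; ^-homo)

  helly : IsHelly (Adj H)
  helly = proj₁ hull

  minimal : ∀ S → (∀ u → f u ∈ₛ S) → IsIsometricSub H S → IsHelly (InducedAdj H S) → ∀ x → x ∈ₛ S
  minimal = proj₂ (proj₂ hull)

  -- the idempotent power of r is a retraction whose fixed set contains G,
  -- so by minimality of the hull it fixes everything
  stable-power-identity : ∀ {r} → IsNonexpansive r → (∀ u → r (f u) ≡ f u) →
                          ∀ v → (r ^ stable-exponent (n H)) v ≡ v
  stable-power-identity {r} r-ne r-fixes-G v =
    ∈⇒fixed (minimal Fixed (λ u → fixed⇒∈ (^-fixes (r-fixes-G u) M)) fixed-isometric (fixed-helly helly) v)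
    where
      M : ℕ
      M = stable-exponent (n H)
      open Retract H (r ^ M) (^-nonexpansive r-ne M) (Stabilisation.stable-idempotent r)

  -- as r ^ M is the identity and M ≥ 1, the map r ^ (M - 1) undoes r
  undo : ∀ {r} → IsNonexpansive r → (∀ u → r (f u) ≡ f u) →
         ∀ v → ∃ λ j → (r ^ j) (r v) ≡ v
  undo {r} r-ne r-fixes-G v = j , (begin
    (r ^ j) (r v)   ≡⟨ cong-app (sym (^-homo r j 1)) v ⟩
    (r ^ (j + 1)) v ≡⟨ cong (λ t → (r ^ t) v) (m∸n+n≡m (stable-exponent-positive v)) ⟩
    (r ^ M) v       ≡⟨ stable-power-identity r-ne r-fixes-G v ⟩
    v               ∎)
    where
      open ≡-Reasoning
      M : ℕ
      M = stable-exponent (n H)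
      j : ℕ
      j = M ∸ 1

module Gate (G H : Graph) (f : V G → V H) (hull : IsInjectiveHull G H f) where

  open Metric H
  open Nonexpansive H
  open Rigidity G H f hull
  open HellyExtension helly
  open Endo (V H) using (_^_)

  pull-towards : ∀ {x y} k (cs : List (V H)) → All (λ c → Within (Adj H) c y (d c x + k)) cs →
                 ∃ λ z → Within (Adj H) y z k × All (λ c → Within (Adj H) c z (d c x)) cs
  pull-towards {x} {y} k cs short with helly ((y , k) ∷ map centre cs) meet
    where
      centre : V H → V H × ℕ
      centre c = c , d c x
      through-x : ∀ c → InDisk (Adj H) (centre c) x
      through-x c = within-walk (geodesic c x)
      between : ∀ {c} → c ∈ cs → ∃ λ w → InDisk (Adj H) (y , k) w × InDisk (Adj H) (centre c) w
      between c∈cs with All.lookup short c∈cs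
      ... | m , m≤ , W with split-walk _ k W m≤
      ... | w , cw , wy = w , within-rev wy , cw
      meet : ∀ D₁ D₂ → D₁ ∈ (y , k) ∷ map centre cs → D₂ ∈ (y , k) ∷ map centre cs →
             ∃ λ u → InDisk (Adj H) D₁ u × InDisk (Adj H) D₂ u
      meet _ _ (here refl) (here refl) = y , within-here , within-here
      meet _ _ (here refl) (there j) with ∈-map⁻ centre j
      ... | _ , c∈cs , refl = between c∈cs
      meet _ _ (there i) (here refl) with ∈-map⁻ centre i
      ... | _ , c∈cs , refl with between c∈cs
      ... | w , yw , cw = w , cw , yw
      meet _ _ (there i) (there j) with ∈-map⁻ centre i | ∈-map⁻ centre j
      ... | c , _ , refl | c' , _ , refl = x , through-x c , through-x c'
  ... | z , yz ∷ czs = z , yz , map⁻ czs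

  real : List (V H)
  real = map f (allFin (n G))

  real-∈ : ∀ u → f u ∈ real
  real-∈ u = ∈-map⁺ f (∈-allFin u)

  -- a vertex z that is no farther than x from y and from every real vertex is
  -- also no closer to y than x: the map x ↦ z fixing y and G extends to a
  -- nonexpansive r, and the power of r undoing it maps (y,z)-walks to (y,x)-walks
  no-closer-point : ∀ {x y z} → (∀ {m} → Walk (Adj H) y x m → Within (Adj H) y z m) →
                    (∀ u {m} → Walk (Adj H) (f u) x m → Within (Adj H) (f u) z m) →
                    ∀ {m} → Walk (Adj H) y z m → Within (Adj H) y x m
  no-closer-point {x} {y} {z} y-closer real-closer {m} W =
    subst₂ (λ a b → Within (Adj H) a b m) rʲ-y≡y rʲ-z≡x (^-nonexpansive r-ne j W)
    where
      moved : List (V H × V H)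
      moved = (x , z) ∷ map (λ c → c , c) (y ∷ real)

      closer : ∀ {c} → c ∈ real → ∀ {m} → Walk (Adj H) c x m → Within (Adj H) c z m
      closer c∈ with ∈-map⁻ f c∈
      ... | u , _ , refl = real-closer u

      extension : ∃ λ r → IsNonexpansive r × (∀ {a q} → (a , q) ∈ moved → r a ≡ q)
      extension = extend moved (move-one (y ∷ real) (y-closer ∷ All.tabulate closer))

      r : V H → V H
      r = proj₁ extension

      r-ne : IsNonexpansive r
      r-ne = proj₁ (proj₂ extension)

      r-agrees : ∀ {a q} → (a , q) ∈ moved → r a ≡ q
      r-agrees = proj₂ (proj₂ extension)

      returning : ∃ λ j → (r ^ j) (r x) ≡ x
      returning = undo r-ne (λ u → r-agrees (there (there (∈-map⁺ (λ c → c , c) (real-∈ u))))) x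

      j : ℕ
      j = proj₁ returning

      rʲ-y≡y : (r ^ j) y ≡ y
      rʲ-y≡y = ^-fixes (r-agrees (there (here refl))) j

      rʲ-z≡x : (r ^ j) z ≡ x
      rʲ-z≡x = trans (cong (r ^ j) (sym (r-agrees (here refl)))) (proj₂ returning)

  -- if d(x,y) > k, then d(u,y) ≤ d(u,x) + k cannot hold for every real u:
  -- otherwise Helly provides a vertex z within k of y that is no farther than x
  -- from y and from all real vertices, contradicting no-closer-point
  no-uniform-shortcut : ∀ {x y k} → (∀ m → Walk (Adj H) x y m → suc k ≤ m) →
                        (∀ u → Within (Adj H) (f u) y (d (f u) x + k)) → ⊥
  no-uniform-shortcut {x} {y} {k} x-y-far short =
    refute (pull-towards k (y ∷ real) (within-here ∷ All.tabulate short-real))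
    where
      short-real : ∀ {c} → c ∈ real → Within (Adj H) c y (d c x + k)
      short-real c∈ with ∈-map⁻ f c∈
      ... | u , _ , refl = short u

      refute : (∃ λ z → Within (Adj H) y z k × All (λ c → Within (Adj H) c z (d c x)) (y ∷ real)) → ⊥
      refute (z , (l , l≤k , yz) , _ ∷ real-near) = too-short (no-closer-point y-closer real-closer yz)
        where
          y-closer : ∀ {m} → Walk (Adj H) y x m → Within (Adj H) y z m
          y-closer W = l , ≤-trans l≤k (≤-trans (n≤1+n k) (x-y-far _ (rev W))) , yz
          real-closer : ∀ u {m} → Walk (Adj H) (f u) x m → Within (Adj H) (f u) z m
          real-closer u W = within-weaken (d-min W) (All.lookup real-near (real-∈ u))
          too-short : Within (Adj H) y x l → ⊥
          too-short (m , m≤l , yx) = <⇒≱ (s≤s (≤-trans m≤l l≤k)) (x-y-far m (rev yx))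

  gate : ∀ {x y k} (P : Walk (Adj H) x y k) → IsShortest (Adj H) P →
         ∃ λ u → ∃ λ a → ∃ λ (Q : Walk (Adj H) (f u) x a) → IsShortest (Adj H) (Q ++w P)
  gate {x} here _ =
    nonempty G , _ , geodesic (f (nonempty G)) x , λ m W → subst (_≤ m) (sym (+-identityʳ _)) (d-min W)
  gate {x} {y} {suc k} P P-short with all? (λ u → within? (d (f u) x + k) (f u) y)
  ... | yes all-short = ⊥-elim (no-uniform-shortcut P-short all-short)
  ... | no ¬all-short with ¬∀⟶∃¬ (n G) _ (λ u → within? (d (f u) x + k) (f u) y) ¬all-short
  ... | u , far = u , d (f u) x , geodesic (f u) x , λ m W →
          ≮⇒≥ λ m<a+1+k → far (m , ≤-pred (subst (m <_) (+-suc (d (f u) x) k) m<a+1+k) , W)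

open Gate using (gate)
open Metric using (rev; reverse-shortest; reverse-shortest-regroup)

-- Extend P backwards to a real vertex u, then extend the reversed result
-- backwards to a real vertex v; reversing back gives the shortest (u,v)-path.
proposition2 : ∀ (G H : Graph) (f : V G → V H) → IsInjectiveHull G H f →
    ∀ {x y k} (P : Walk (Adj H) x y k) → IsShortest (Adj H) P →
    ∃ λ x' → ∃ λ y' → ∃ λ k' → ∃ λ (P' : Walk (Adj H) (f x') (f y') k') →
      IsShortest (Adj H) P' × SubgraphOf (Adj H) P P'
proposition2 G H f hull P P-short
  with u , _ , Q₁ , Q₁P-short ← gate G H f hull P P-short
  with v , _ , Q₂ , Q₂-short ← gate G H f hull (rev H (Q₁ ++w P)) (reverse-shortest H (Q₁ ++w P) Q₁P-short)
  = u , v , _ , Q₁ ++w (P ++w rev H Q₂) ,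
    reverse-shortest-regroup H Q₁ P Q₂ Q₂-short ,
    subgraph-middle Q₁ P (rev H Q₂)
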